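{- Let $p$ be an odd prime, let $\alpha>1$ be any integer with $\gcd(\alpha,p)=1$, and let $\gamma=\operatorname{ord}_p(\alpha)$. Then for all $a,n\in\mathbb{N}$ with $a\ge\gamma p$, $$S_p^n(a)\le 8\,\big(\log_p a\big)^{n-1}\,a^{\log_p\left(\frac{p+1}{2}\right)}.$$
   Context: A base-$p$ digit $d\in\{0,\dots,p-1\}$ is called large if $d>p/2$. For $a,n\in\mathbb{N}$, $S_p^n(a)=\#\{0\le s<a : \text{the base- }p\text{ representation of }\alpha^s\text{ contains fewer than }n\text{ large digits}\}$. -}

module Defs where

open import Data.Nat using (ℕ; zero; suc; _+_; _*_; _^_; _≤_; _<_; _<?_; NonZero)
open import Data.Nat.DivMod using (_/_; _%_)
open import Data.Bool using (if_then_else_)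
open import Relation.Nullary using (does)
open import Relation.Binary.PropositionalEquality using (_≡_)

-- A base-p digit d is large iff d > p/2, i.e. p < 2 * d.
-- The fuel argument (initialised to m) is always sufficient since m / p < m.
largeDigitCount : (p : ℕ) → .{{NonZero p}} → ℕ → ℕ
largeDigitCount p m = go m m
  where
  go : ℕ → ℕ → ℕ
  go zero    _ = 0
  go (suc f) zero = 0
  go (suc f) (suc k) =
    (if does (p <? 2 * (suc k % p)) then 1 else 0) + go f (suc k / p)

S : (p : ℕ) → .{{NonZero p}} → (α n a : ℕ) → ℕ
S p α n zero = 0
S p α n (suc a) =
  S p α n a + (if does (largeDigitCount p (α ^ a) <? n) then 1 else 0)

IsOrderMod : (p : ℕ) → .{{NonZero p}} → (α γ : ℕ) → Set
IsOrderMod p α γ =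
  (1 ≤ γ) × (α ^ γ % p ≡ 1 % p) × (∀ k → 1 ≤ k → α ^ k % p ≡ 1 % p → γ ≤ k)
  where open import Data.Product using (_×_)

-- BoundHolds p n a T  encodes the real inequality
--     T ≤ 8 · (log_p a)^(n-1) · a^(log_p((p+1)/2))
-- (valid for a ≥ p, so x = log_p a ≥ 1). Writing the right side as
-- f(x) = 8 x^(n-1) ((p+1)/2)^x, it is required for every rational
-- r = u/v (v ≥ 1) with r ≥ x (i.e. a^v ≤ p^u) that T ≤ f(r); after raising
-- to the v-th power and clearing (positive) denominators this reads
--   T^v · u^v · v^(n·v) · 2^u ≤ 8^v · u^(n·v) · v^v · (p+1)^u.
-- Since f is continuous, and nondecreasing on [1,∞) when n ≥ 1 (for n = 0,
-- T = S_p^0(a) = 0), this is equivalent to T ≤ f(log_p a).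
BoundHolds : (p n a T : ℕ) → Set
BoundHolds p n a T =
  ∀ u v → 1 ≤ v → a ^ v ≤ p ^ u →
  T ^ v * u ^ v * v ^ (n * v) * 2 ^ u ≤ 8 ^ v * u ^ (n * v) * v ^ v * (p + 1) ^ u

{-# OPTIONS --safe #-}
module Submission where

-- Write α ^ γ = 1 + p ^ (s + 1) m with p ∤ m.  By lifting the exponent,
-- α ^ (γ d) ≢ 1 (mod p ^ (s + 1 + K)) for 0 < d < p ^ K, so along a residue class
-- c + j γ (j < p ^ K) the K base-p digits of α ^ (c + j γ) just above the lowest s + 1
-- are pairwise distinct.  They contain no more large digits than α ^ (c + j γ), so each
-- class contributes at most C(K, n), the number of w < p ^ K with fewer than n large
-- digits.  Splitting off the last digit (M = (p + 1)/2 small and h = (p - 1)/2 large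
-- values) gives C(K + 1, n) = M C(K, n) + h C(K, n - 1), hence
-- C(K, m + 1) ≤ (K + 1) ^ m M ^ K.  If B is the leading base-p digit of a / γ, in
-- position K, then [0, a) is covered by B + 1 ≤ 2 B blocks of γ p ^ K exponents, so
-- S ≤ 2 B γ C(K, n).  Since B γ p ^ K ≤ a and B γ ≤ p ^ 2 (γ ≤ p by pigeonhole), this
-- is at most 8 (log_p a) ^ (n - 1) M ^ (log_p a) = 8 (log_p a) ^ (n - 1) a ^ (log_p M).

open import Defs
open import Data.Bool.Base using (if_then_else_)
open import Data.Fin.Base using (Fin; toℕ; fromℕ<)
open import Data.Fin.Properties using (pigeonhole; toℕ-fromℕ<; toℕ<n)
open import Data.Nat
open import Data.Nat.Coprimality using (gcd≡1⇒coprime)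
open import Data.Nat.Combinatorics using (_C_; nC1≡n; nCk+nC[k+1]≡[n+1]C[k+1])
open import Data.Nat.Divisibility
open import Data.Nat.DivMod
open import Data.Nat.GCD using (gcd)
open import Data.Nat.Induction using (<-rec)
open import Data.Nat.Primality using (Prime; euclidsLemma; prime⇒nonTrivial)
open import Data.Nat.Properties
open import Data.Nat.Tactic.RingSolver using (solve-∀)
open import Data.Product using (∃; ∃₂; _×_; _,_; proj₁; proj₂)
open import Data.Sum using (inj₁; inj₂)
open import Function.Base using (_∘_; case_of_)
open import Relation.Binary.Definitions using (tri<; tri≈; tri>)
open import Relation.Binary.PropositionalEquality
open import Relation.Nullary using (Dec; yes; no; does; ¬_; contradiction)

private
  variable
    a b m n : ℕ

-- Indicators and finite sums

𝟙 : ∀ {P : Set} → Dec P → ℕ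
𝟙 d = if does d then 1 else 0

𝟙-yes : ∀ {P : Set} (d : Dec P) → P → 𝟙 d ≡ 1
𝟙-yes (yes _) _ = refl
𝟙-yes (no ¬P) P = contradiction P ¬P

𝟙-no : ∀ {P : Set} (d : Dec P) → ¬ P → 𝟙 d ≡ 0
𝟙-no (yes P) ¬P = contradiction P ¬P
𝟙-no (no _)  _  = refl

𝟙≤1 : ∀ {P : Set} (d : Dec P) → 𝟙 d ≤ 1
𝟙≤1 (yes _) = ≤-refl
𝟙≤1 (no _)  = z≤n

𝟙-mono : ∀ {P Q : Set} (dP : Dec P) (dQ : Dec Q) → (P → Q) → 𝟙 dP ≤ 𝟙 dQ
𝟙-mono (yes _) (yes _) _   = ≤-refl
𝟙-mono (no _)  _       _   = z≤n
𝟙-mono (yes P) (no ¬Q) P⇒Q = contradiction (P⇒Q P) ¬Q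

∑ : ℕ → (ℕ → ℕ) → ℕ
∑ zero    f = 0
∑ (suc n) f = ∑ n f + f n

syntax ∑ n (λ i → e) = ∑[ i < n ] e

module _ {f g : ℕ → ℕ} where

  ∑-cong : ∀ n → (∀ {i} → i < n → f i ≡ g i) → ∑ n f ≡ ∑ n g
  ∑-cong zero    eq = refl
  ∑-cong (suc n) eq = cong₂ _+_ (∑-cong n (eq ∘ m<n⇒m<1+n)) (eq ≤-refl)

  ∑-mono-≤ : ∀ n → (∀ {i} → i < n → f i ≤ g i) → ∑ n f ≤ ∑ n g
  ∑-mono-≤ zero    le = z≤n
  ∑-mono-≤ (suc n) le = +-mono-≤ (∑-mono-≤ n (le ∘ m<n⇒m<1+n)) (le ≤-refl)

  ∑-distrib-+ : ∀ n → ∑[ i < n ] (f i + g i) ≡ ∑ n f + ∑ n g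
  ∑-distrib-+ zero    = refl
  ∑-distrib-+ (suc n) = begin
    ∑[ i < n ] (f i + g i) + (f n + g n) ≡⟨ cong (_+ (f n + g n)) (∑-distrib-+ n) ⟩
    ∑ n f + ∑ n g + (f n + g n)          ≡⟨ interchange (∑ n f) (∑ n g) (f n) (g n) ⟩
    ∑ n f + f n + (∑ n g + g n)          ∎
    where
    open ≡-Reasoning
    interchange : ∀ a b c d → a + b + (c + d) ≡ a + c + (b + d)
    interchange = solve-∀

∑-const : ∀ n c → ∑[ i < n ] c ≡ n * c
∑-const zero    c = refl
∑-const (suc n) c = trans (cong (_+ c) (∑-const n c)) (+-comm (n * c) c)

∑-zero : ∀ n {f : ℕ → ℕ} → (∀ {i} → i < n → f i ≡ 0) → ∑ n f ≡ 0
∑-zero n eq = trans (∑-cong n eq) (trans (∑-const n 0) (*-zeroʳ n))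

∑-*ˡ : ∀ n c (f : ℕ → ℕ) → ∑[ i < n ] (c * f i) ≡ c * ∑ n f
∑-*ˡ zero    c f = sym (*-zeroʳ c)
∑-*ˡ (suc n) c f = trans (cong (_+ c * f n) (∑-*ˡ n c f)) (sym (*-distribˡ-+ c (∑ n f) (f n)))

∑-*ʳ : ∀ n c (f : ℕ → ℕ) → ∑[ i < n ] (f i * c) ≡ ∑ n f * c
∑-*ʳ n c f = trans (∑-cong n (λ {i} _ → *-comm (f i) c)) (trans (∑-*ˡ n c f) (*-comm c (∑ n f)))

∑-+ : ∀ m n (f : ℕ → ℕ) → ∑ (m + n) f ≡ ∑ m f + ∑[ i < n ] f (m + i)
∑-+ m zero    f = trans (cong (λ k → ∑ k f) (+-identityʳ m)) (sym (+-identityʳ (∑ m f)))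
∑-+ m (suc n) f = begin
  ∑ (m + suc n) f                            ≡⟨ cong (λ k → ∑ k f) (+-suc m n) ⟩
  ∑ (m + n) f + f (m + n)                    ≡⟨ cong (_+ f (m + n)) (∑-+ m n f) ⟩
  ∑ m f + ∑[ i < n ] f (m + i) + f (m + n)   ≡⟨ +-assoc (∑ m f) _ _ ⟩
  ∑ m f + (∑[ i < n ] f (m + i) + f (m + n)) ∎
  where open ≡-Reasoning

∑-monoˡ-≤ : ∀ (f : ℕ → ℕ) → m ≤ n → ∑ m f ≤ ∑ n f
∑-monoˡ-≤ {m} {n} f m≤n = begin
  ∑ m f                            ≤⟨ m≤m+n (∑ m f) _ ⟩
  ∑ m f + ∑[ i < n ∸ m ] f (m + i) ≡⟨ ∑-+ m (n ∸ m) f ⟨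
  ∑ (m + (n ∸ m)) f                ≡⟨ cong (λ k → ∑ k f) (m+[n∸m]≡n m≤n) ⟩
  ∑ n f                            ∎
  where open ≤-Reasoning

∑-* : ∀ m n (f : ℕ → ℕ) → ∑ (m * n) f ≡ ∑[ j < m ] ∑[ i < n ] f (i + j * n)
∑-* zero    n f = refl
∑-* (suc m) n f = begin
  ∑ (n + m * n) f
    ≡⟨ cong (λ k → ∑ k f) (+-comm n (m * n)) ⟩
  ∑ (m * n + n) f
    ≡⟨ ∑-+ (m * n) n f ⟩
  ∑ (m * n) f + ∑[ i < n ] f (m * n + i)
    ≡⟨ cong₂ _+_ (∑-* m n f) (∑-cong n (λ {i} _ → cong f (+-comm (m * n) i))) ⟩
  ∑[ j < m ] ∑[ i < n ] f (i + j * n) + ∑[ i < n ] f (i + m * n)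
    ∎
  where open ≡-Reasoning

∑-comm : ∀ m n (f : ℕ → ℕ → ℕ) → ∑[ i < m ] ∑[ j < n ] f i j ≡ ∑[ j < n ] ∑[ i < m ] f i j
∑-comm zero    n f = sym (∑-zero n (λ _ → refl))
∑-comm (suc m) n f = trans (cong (_+ ∑[ j < n ] f m j) (∑-comm m n f)) (sym (∑-distrib-+ n))

∑-sift : ∀ {x} n (h : ℕ → ℕ) → x < n → ∑[ w < n ] (𝟙 (x ≟ w) * h w) ≡ h x
∑-sift {x} (suc n) h x<1+n with x ≟ n
... | yes refl = begin
  ∑[ w < n ] (𝟙 (x ≟ w) * h w) + 𝟙 (x ≟ x) * h x
    ≡⟨ cong₂ _+_ (∑-zero n off-diagonal) (cong (_* h x) (𝟙-yes (x ≟ x) refl)) ⟩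
  0 + 1 * h x
    ≡⟨ *-identityˡ (h x) ⟩
  h x
    ∎
  where
  open ≡-Reasoning
  off-diagonal : ∀ {w} → w < x → 𝟙 (x ≟ w) * h w ≡ 0
  off-diagonal w<x = cong (_* h _) (𝟙-no (x ≟ _) (>⇒≢ w<x))
... | no x≢n = begin
  ∑[ w < n ] (𝟙 (x ≟ w) * h w) + 𝟙 (x ≟ n) * h n
    ≡⟨ cong (λ z → ∑[ w < n ] (𝟙 (x ≟ w) * h w) + z * h n) (𝟙-no (x ≟ n) x≢n) ⟩
  ∑[ w < n ] (𝟙 (x ≟ w) * h w) + 0
    ≡⟨ +-identityʳ _ ⟩
  ∑[ w < n ] (𝟙 (x ≟ w) * h w)
    ≡⟨ ∑-sift n h (≤∧≢⇒< (≤-pred x<1+n) x≢n) ⟩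
  h x
    ∎
  where open ≡-Reasoning

module _ {m n : ℕ} (f : ℕ → ℕ) (f< : ∀ {i} → i < m → f i < n)
         (f-injective : ∀ {i j} → i < m → j < m → f i ≡ f j → i ≡ j) where

  private
    fibre≤1 : ∀ {k} → k ≤ m → ∀ w → ∑[ i < k ] 𝟙 (f i ≟ w) ≤ 1
    fibre≤1 {zero}  _     w = z≤n
    fibre≤1 {suc k} 1+k≤m w with f k ≟ w
    ... | yes fk≡w = ≤-reflexive (cong₂ _+_ (∑-zero k missed) (𝟙-yes (f k ≟ w) fk≡w))
      where
      missed : ∀ {i} → i < k → 𝟙 (f i ≟ w) ≡ 0
      missed {i} i<k = 𝟙-no (f i ≟ w) λ fi≡w →
        <-irrefl (f-injective (<-trans i<k 1+k≤m) 1+k≤m (trans fi≡w (sym fk≡w))) i<k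
    ... | no fk≢w =
      +-mono-≤ (fibre≤1 (≤-trans (n≤1+n k) 1+k≤m) w) (≤-reflexive (𝟙-no (f k ≟ w) fk≢w))

  ∑-injective-≤ : (h : ℕ → ℕ) → ∑[ i < m ] h (f i) ≤ ∑ n h
  ∑-injective-≤ h = begin
    ∑[ i < m ] h (f i)
      ≡⟨ ∑-cong m (λ i<m → ∑-sift n h (f< i<m)) ⟨
    ∑[ i < m ] ∑[ w < n ] (𝟙 (f i ≟ w) * h w)
      ≡⟨ ∑-comm m n _ ⟩
    ∑[ w < n ] ∑[ i < m ] (𝟙 (f i ≟ w) * h w)
      ≡⟨ ∑-cong n (λ {w} _ → ∑-*ʳ m (h w) _) ⟩
    ∑[ w < n ] (∑[ i < m ] 𝟙 (f i ≟ w) * h w)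
      ≤⟨ ∑-mono-≤ n (λ {w} _ → *-monoˡ-≤ (h w) (fibre≤1 ≤-refl w)) ⟩
    ∑[ w < n ] (1 * h w)
      ≡⟨ ∑-cong n (λ {w} _ → *-identityˡ (h w)) ⟩
    ∑ n h
      ∎
    where open ≤-Reasoning

-- Divisibility and powers

[m+n]%d≡m%d⇒d∣n : ∀ m n d .{{_ : NonZero d}} → (m + n) % d ≡ m % d → d ∣ n
[m+n]%d≡m%d⇒d∣n m n d eq =
  ∣m+n∣m⇒∣n (divides ((m + n) / d) (+-cancelˡ-≡ (m % d) _ _ split)) (n∣m*n (m / d))
  where
  open ≡-Reasoning
  split : m % d + (m / d * d + n) ≡ m % d + (m + n) / d * d
  split = begin
    m % d + (m / d * d + n)       ≡⟨ +-assoc (m % d) _ n ⟨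
    m % d + m / d * d + n         ≡⟨ cong (_+ n) (m≡m%n+[m/n]*n m d) ⟨
    m + n                         ≡⟨ m≡m%n+[m/n]*n (m + n) d ⟩
    (m + n) % d + (m + n) / d * d ≡⟨ cong (_+ (m + n) / d * d) eq ⟩
    m % d + (m + n) / d * d       ∎

odd⇒≡1+2*[n/2] : ∀ n → n % 2 ≡ 1 → n ≡ 1 + 2 * (n / 2)
odd⇒≡1+2*[n/2] n n%2≡1 = trans (m≡m%n+[m/n]*n n 2) (cong₂ _+_ n%2≡1 (*-comm (n / 2) 2))

^-distribʳ-* : ∀ m n k → (m * n) ^ k ≡ m ^ k * n ^ k
^-distribʳ-* m n zero    = refl
^-distribʳ-* m n (suc k) = trans (cong (m * n *_) (^-distribʳ-* m n k)) (interchange m n (m ^ k) (n ^ k))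
  where
  interchange : ∀ a b c d → a * b * (c * d) ≡ a * c * (b * d)
  interchange = solve-∀

^-cancelʳ-≤ : ∀ {p i j} → 1 < p → p ^ i ≤ p ^ j → i ≤ j
^-cancelʳ-≤ {p} {i} {j} 1<p p^i≤p^j with i ≤? j
... | yes i≤j = i≤j
... | no  i≰j = contradiction p^i≤p^j (<⇒≱ (^-monoʳ-< p 1<p (≰⇒> i≰j)))

prime⇒1<p : ∀ {p} → Prime p → 1 < p
prime⇒1<p {p} p-prime = nonTrivial⇒n>1 p {{prime⇒nonTrivial p-prime}}

gcd≡1⇒∤ : ∀ {p α} → 1 < p → gcd α p ≡ 1 → ¬ p ∣ α
gcd≡1⇒∤ 1<p gcd≡1 p∣α = <⇒≢ 1<p (sym (gcd≡1⇒coprime gcd≡1 (p∣α , ∣-refl)))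

module _ {p : ℕ} .{{_ : NonZero p}} (p-prime : Prime p) where

  ∣*∧∤⇒∣ : p ∣ a * b → ¬ p ∣ a → p ∣ b
  ∣*∧∤⇒∣ {a} {b} p∣ab p∤a with euclidsLemma a b p-prime p∣ab
  ... | inj₁ p∣a = contradiction p∣a p∤a
  ... | inj₂ p∣b = p∣b

  ∤⇒∤^ : ¬ p ∣ a → ∀ e → ¬ p ∣ a ^ e
  ∤⇒∤^ p∤a zero    p∣1       = <-irrefl (sym (∣1⇒≡1 p∣1)) (prime⇒1<p p-prime)
  ∤⇒∤^ p∤a (suc e) p∣a^[1+e] = ∤⇒∤^ p∤a e (∣*∧∤⇒∣ p∣a^[1+e] p∤a)

  ∣p^[1+k]⇒∣ : ∀ k → p ^ suc k ∣ n → p ∣ n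
  ∣p^[1+k]⇒∣ k = ∣-trans (m∣m*n (p ^ k))

  ^∣*∧∤⇒^∣ : ∀ k → p ^ k ∣ a * b → ¬ p ∣ a → p ^ k ∣ b
  ^∣*∧∤⇒^∣         zero    _          _   = 1∣ _
  ^∣*∧∤⇒^∣ {a} {b} (suc k) p^[1+k]∣ab p∤a with ∣*∧∤⇒∣ (∣p^[1+k]⇒∣ k p^[1+k]∣ab) p∤a
  ... | divides-refl b′ =
    subst (p ^ suc k ∣_) (*-comm p b′) (*-monoʳ-∣ p (^∣*∧∤⇒^∣ k p^k∣ab′ p∤a))
    where
    p^k∣ab′ : p ^ k ∣ a * b′
    p^k∣ab′ = *-cancelʳ-∣ p (subst₂ _∣_ (*-comm p (p ^ k)) (sym (*-assoc a b′ p)) p^[1+k]∣ab)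

split-prime-power : ∀ {p} → 1 < p → ∀ q → 0 < q → ∃₂ λ t m → ¬ p ∣ m × q ≡ p ^ t * m
split-prime-power {p} 1<p = <-rec _ split
  where
  instance
    p-nonZero : NonZero p
    p-nonZero = >-nonZero (<-trans z<s 1<p)
  split : ∀ q → (∀ {q′} → q′ < q → 0 < q′ → ∃₂ λ t m → ¬ p ∣ m × q′ ≡ p ^ t * m) →
                0 < q → ∃₂ λ t m → ¬ p ∣ m × q ≡ p ^ t * m
  split q rec 0<q with p ∣? q
  ... | no p∤q = 0 , q , p∤q , sym (+-identityʳ q)
  ... | yes (divides-refl q′) with rec (m<m*n q′ p {{>-nonZero 0<q′}} 1<p) 0<q′
    where
    0<q′ : 0 < q′
    0<q′ = n≢0⇒n>0 λ { refl → <-irrefl refl 0<q }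
  ... | t , m , p∤m , q′≡p^t*m = suc t , m , p∤m , (begin
    q′ * p        ≡⟨ cong (_* p) q′≡p^t*m ⟩
    p ^ t * m * p ≡⟨ rotate (p ^ t) m p ⟩
    p * p ^ t * m ∎)
    where
    open ≡-Reasoning
    rotate : ∀ a b c → a * b * c ≡ c * a * b
    rotate = solve-∀

2*nC2+n≡n*n : ∀ n → 2 * (n C 2) + n ≡ n * n
2*nC2+n≡n*n zero    = refl
2*nC2+n≡n*n (suc n) = begin
  2 * (suc n C 2) + suc n         ≡⟨ cong (λ c → 2 * c + suc n) (nCk+nC[k+1]≡[n+1]C[k+1] n 1) ⟨
  2 * (n C 1 + n C 2) + suc n     ≡⟨ cong (λ c → 2 * (c + n C 2) + suc n) (nC1≡n n) ⟩
  2 * (n + n C 2) + suc n         ≡⟨ regroup n (n C 2) ⟩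
  (2 * (n C 2) + n) + (2 * n + 1) ≡⟨ cong (_+ (2 * n + 1)) (2*nC2+n≡n*n n) ⟩
  n * n + (2 * n + 1)             ≡⟨ square-suc n ⟩
  suc n * suc n                   ∎
  where
  open ≡-Reasoning
  regroup : ∀ n c → 2 * (n + c) + suc n ≡ (2 * c + n) + (2 * n + 1)
  regroup = solve-∀
  square-suc : ∀ n → n * n + (2 * n + 1) ≡ suc n * suc n
  square-suc = solve-∀

[1+2h]C2≡[1+2h]*h : ∀ h → (1 + 2 * h) C 2 ≡ (1 + 2 * h) * h
[1+2h]C2≡[1+2h]*h h = *-cancelˡ-≡ _ _ 2 (+-cancelʳ-≡ (1 + 2 * h) _ _ (begin
  2 * ((1 + 2 * h) C 2) + (1 + 2 * h) ≡⟨ 2*nC2+n≡n*n (1 + 2 * h) ⟩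
  (1 + 2 * h) * (1 + 2 * h)           ≡⟨ odd-square h ⟩
  2 * ((1 + 2 * h) * h) + (1 + 2 * h) ∎))
  where
  open ≡-Reasoning
  odd-square : ∀ h → (1 + 2 * h) * (1 + 2 * h) ≡ 2 * ((1 + 2 * h) * h) + (1 + 2 * h)
  odd-square = solve-∀

binomial₃ : ∀ x d → ∃ λ z → (1 + x) ^ d ≡ 1 + d * x + (d C 2) * (x * x) + x * x * x * z
binomial₃ x zero    = 0 , sym (cong suc (*-zeroʳ (x * x * x)))
binomial₃ x (suc d) with binomial₃ x d
... | z , eq = (d C 2) + z + x * z , (begin
  (1 + x) * (1 + x) ^ d
    ≡⟨ cong ((1 + x) *_) eq ⟩
  (1 + x) * (1 + d * x + (d C 2) * (x * x) + x * x * x * z)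
    ≡⟨ expand x d (d C 2) z ⟩
  1 + suc d * x + (d + d C 2) * (x * x) + x * x * x * ((d C 2) + z + x * z)
    ≡⟨ cong (λ c → 1 + suc d * x + c * (x * x) + x * x * x * ((d C 2) + z + x * z)) pascal ⟩
  1 + suc d * x + (suc d C 2) * (x * x) + x * x * x * ((d C 2) + z + x * z)
    ∎)
  where
  open ≡-Reasoning
  expand : ∀ x d c z → (1 + x) * (1 + d * x + c * (x * x) + x * x * x * z) ≡
                       1 + suc d * x + (d + c) * (x * x) + x * x * x * (c + z + x * z)
  expand = solve-∀
  pascal : d + (d C 2) ≡ suc d C 2
  pascal = trans (cong (_+ (d C 2)) (sym (nC1≡n d))) (nCk+nC[k+1]≡[n+1]C[k+1] d 1)

-- Lifting the exponent

module LiftingTheExponent {p h : ℕ} .{{_ : NonZero p}} (p-prime : Prime p) (p≡1+2h : p ≡ 1 + 2 * h)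
  where

  first-order-expansion : ∀ s m d →
    ∃ λ y → (1 + p ^ suc s * m) ^ d ≡ 1 + p ^ suc s * (d * m + p * y)
  first-order-expansion s m d with binomial₃ (p ^ suc s * m) d
  ... | z , eq = (d C 2) * (p ^ s * m * m) + p ^ s * m * m * (p ^ suc s * m) * z
               , trans eq (regroup p (p ^ s) m d (d C 2) z)
    where
    regroup : ∀ p P m d c z →
      1 + d * (p * P * m) + c * (p * P * m * (p * P * m)) + p * P * m * (p * P * m) * (p * P * m) * z ≡
      1 + p * P * (d * m + p * (c * (P * m * m) + P * m * m * (p * P * m) * z))
    regroup = solve-∀

  pth-power : ∀ s {m} → ¬ p ∣ m →
    ∃ λ m′ → ¬ p ∣ m′ × (1 + p ^ suc s * m) ^ p ≡ 1 + p ^ suc (suc s) * m′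
  pth-power s {m} p∤m with binomial₃ (p ^ suc s * m) p
  ... | z , eq = m + p * r , p∤m+pr , (begin
    (1 + x) ^ p
      ≡⟨ eq ⟩
    1 + p * x + (p C 2) * (x * x) + x * x * x * z
      ≡⟨ cong (λ c → 1 + p * x + c * (x * x) + x * x * x * z) pC2≡p*h ⟩
    1 + p * x + (p * h) * (x * x) + x * x * x * z
      ≡⟨ regroup p (p ^ s) m h z ⟩
    1 + p ^ suc (suc s) * (m + p * r)
      ∎)
    where
    open ≡-Reasoning
    x r : ℕ
    x = p ^ suc s * m
    r = h * p ^ s * m * m + p ^ s * p ^ s * m * m * m * z
    pC2≡p*h : p C 2 ≡ p * h
    pC2≡p*h = subst (λ q → q C 2 ≡ q * h) (sym p≡1+2h) ([1+2h]C2≡[1+2h]*h h)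
    p∤m+pr : ¬ p ∣ m + p * r
    p∤m+pr p∣m+pr = p∤m (∣m+n∣m⇒∣n (subst (p ∣_) (+-comm m (p * r)) p∣m+pr) (m∣m*n r))
    regroup : ∀ p P m h z →
      1 + p * (p * P * m) + p * h * (p * P * m * (p * P * m)) + p * P * m * (p * P * m) * (p * P * m) * z ≡
      1 + p * (p * P) * (m + p * (h * P * m * m + P * P * m * m * m * z))
    regroup = solve-∀

  private
    p∣exponent : ∀ s {m d D} → ¬ p ∣ m → (1 + p ^ suc s * m) ^ d ≡ 1 + p ^ suc s * D →
                 p ∣ D → p ∣ d
    p∣exponent s {m} {d} {D} p∤m eq p∣D = ∣*∧∤⇒∣ p-prime (subst (p ∣_) (*-comm d m) p∣dm) p∤m
      where
      y : ℕ
      y = proj₁ (first-order-expansion s m d)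
      D≡dm+py : D ≡ d * m + p * y
      D≡dm+py = *-cancelˡ-≡ D _ (p ^ suc s) {{m^n≢0 p (suc s)}}
                  (suc-injective (trans (sym eq) (proj₂ (first-order-expansion s m d))))
      p∣dm : p ∣ d * m
      p∣dm = ∣m+n∣m⇒∣n (subst (p ∣_) (trans D≡dm+py (+-comm (d * m) (p * y))) p∣D) (m∣m*n y)

  lifting-the-exponent : ∀ K s {m d D} → ¬ p ∣ m →
    (1 + p ^ suc s * m) ^ d ≡ 1 + p ^ suc s * D → p ^ K ∣ D → p ^ K ∣ d
  lifting-the-exponent zero    s _ _ _ = 1∣ _
  lifting-the-exponent (suc K) s {m} {d} p∤m eq p^[1+K]∣D with ∣p^[1+k]⇒∣ p-prime K p^[1+K]∣D
  ... | divides-refl D′ with p∣exponent s {m} {d} p∤m eq (n∣m*n D′)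
  ... | divides-refl e with pth-power s p∤m
  ... | m′ , p∤m′ , eq₁ = subst (_∣ e * p) (*-comm (p ^ K) p) (*-monoˡ-∣ p p^K∣e)
    where
    open ≡-Reasoning
    eq₂ : (1 + p ^ suc (suc s) * m′) ^ e ≡ 1 + p ^ suc (suc s) * D′
    eq₂ = begin
      (1 + p ^ suc (suc s) * m′) ^ e ≡⟨ cong (_^ e) eq₁ ⟨
      ((1 + p ^ suc s * m) ^ p) ^ e  ≡⟨ ^-*-assoc _ p e ⟩
      (1 + p ^ suc s * m) ^ (p * e)  ≡⟨ cong ((1 + p ^ suc s * m) ^_) (*-comm p e) ⟩
      (1 + p ^ suc s * m) ^ (e * p)  ≡⟨ eq ⟩
      1 + p ^ suc s * (D′ * p)       ≡⟨ cong suc (rotate p (p ^ s) D′) ⟩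
      1 + p ^ suc (suc s) * D′       ∎
      where
      rotate : ∀ p P D → p * P * (D * p) ≡ p * (p * P) * D
      rotate = solve-∀
    p^K∣D′ : p ^ K ∣ D′
    p^K∣D′ = *-cancelʳ-∣ p (subst (_∣ D′ * p) (*-comm p (p ^ K)) p^[1+K]∣D)
    p^K∣e : p ^ K ∣ e
    p^K∣e = lifting-the-exponent K (suc s) p∤m′ eq₂ p^K∣D′

-- Large digits

-- largeDigitCount is defined through a fuelled helper local to its where block.
-- Abstracting suc k and suc k / p turns the equation below into a pattern unification
-- problem, whose solution names that helper largeDigitCount-go; this is what lets us
-- show that its fuel is irrelevant.
mutual
  largeDigitCount-go : (p : ℕ) .{{_ : NonZero p}} → ℕ → ℕ → ℕ → ℕ
  largeDigitCount-go = _

  largeDigitCount-suc : ∀ p .{{_ : NonZero p}} k →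
    largeDigitCount p (suc k) ≡ 𝟙 (p <? 2 * (suc k % p)) + largeDigitCount-go p (suc k) k (suc k / p)
  largeDigitCount-suc p k with suc k / p
  ... | y with suc k
  ...   | m = refl

module LargeDigits {p : ℕ} .{{_ : NonZero p}} (1<p : 1 < p) where

  L : ℕ → ℕ
  L = largeDigitCount p

  large : ℕ → ℕ
  large d = 𝟙 (p <? 2 * d)

  private
    [1+k]/p≤k : ∀ k → suc k / p ≤ k
    [1+k]/p≤k k = ≤-pred (m/n<m (suc k) p 1<p)

    fuel-irrelevant : ∀ m m′ f f′ y → y ≤ f → y ≤ f′ →
                      largeDigitCount-go p m f y ≡ largeDigitCount-go p m′ f′ y
    fuel-irrelevant m m′ zero    zero     zero    _         _          = refl
    fuel-irrelevant m m′ zero    (suc f′) zero    _         _          = refl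
    fuel-irrelevant m m′ (suc f) zero     zero    _         _          = refl
    fuel-irrelevant m m′ (suc f) (suc f′) zero    _         _          = refl
    fuel-irrelevant m m′ (suc f) (suc f′) (suc k) (s≤s k≤f) (s≤s k≤f′) =
      cong (large (suc k % p) +_) (fuel-irrelevant m m′ f f′ (suc k / p)
        (≤-trans ([1+k]/p≤k k) k≤f) (≤-trans ([1+k]/p≤k k) k≤f′))

  L-step : ∀ x → L x ≡ large (x % p) + L (x / p)
  L-step zero    = sym (cong₂ _+_ large[0%p]≡0 (cong L (0/n≡0 p)))
    where
    large[0%p]≡0 : large (0 % p) ≡ 0
    large[0%p]≡0 = 𝟙-no (p <? 2 * (0 % p)) λ p<2*[0%p] →
      <⇒≱ p<2*[0%p] (≤-trans (≤-reflexive (cong (2 *_) (m<n⇒m%n≡m (<-trans z<s 1<p)))) z≤n)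
  L-step (suc k) = trans (largeDigitCount-suc p k) (cong (large (suc k % p) +_)
    (fuel-irrelevant (suc k) (suc k / p) k (suc k / p) (suc k / p) ([1+k]/p≤k k) ≤-refl))

  L-digit : ∀ {r} w → r < p → L (r + w * p) ≡ large r + L w
  L-digit {r} w r<p = trans (L-step (r + w * p)) (cong₂ (λ d v → large d + L v) low-digit high-digits)
    where
    low-digit : (r + w * p) % p ≡ r
    low-digit = trans ([m+kn]%n≡m%n r w p) (m<n⇒m%n≡m r<p)
    high-digits : (r + w * p) / p ≡ w
    high-digits = trans (+-distrib-/-∣ʳ r (n∣m*n w)) (cong₂ _+_ (m<n⇒m/n≡0 r<p) (m*n/n≡m w p))

  L-/p^ : ∀ t x → L (_/_ x (p ^ t) {{m^n≢0 p t}}) ≤ L x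
  L-/p^ zero    x = ≤-reflexive (cong L (n/1≡n x))
  L-/p^ (suc t) x = begin
    L (x / (p * p ^ t))       ≡⟨ cong L (m/n/o≡m/[n*o] x p (p ^ t)) ⟨
    L (x / p / p ^ t)         ≤⟨ L-/p^ t (x / p) ⟩
    L (x / p)                 ≤⟨ m≤n+m (L (x / p)) (large (x % p)) ⟩
    large (x % p) + L (x / p) ≡⟨ L-step x ⟨
    L x                       ∎
    where
    open ≤-Reasoning
    instance
      _ = m^n≢0 p t
      _ = m^n≢0 p (suc t)

  L-%p^ : ∀ K x → L (_%_ x (p ^ K) {{m^n≢0 p K}}) ≤ L x
  L-%p^ zero    x = ≤-trans (≤-reflexive (cong L (n%1≡0 x))) z≤n
  L-%p^ (suc K) x = begin
    L (x % (p * p ^ K))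
      ≡⟨ L-step _ ⟩
    large (x % (p * p ^ K) % p) + L (x % (p * p ^ K) / p)
      ≡⟨ cong₂ (λ d v → large d + L v) low-digit high-digits ⟩
    large (x % p) + L (x / p % p ^ K)
      ≤⟨ +-monoʳ-≤ (large (x % p)) (L-%p^ K (x / p)) ⟩
    large (x % p) + L (x / p)
      ≡⟨ L-step x ⟨
    L x
      ∎
    where
    open ≤-Reasoning
    instance
      _ = m^n≢0 p K
      _ = m^n≢0 p (suc K)
      _ = m*n≢0 (p ^ K) p
    low-digit : x % (p * p ^ K) % p ≡ x % p
    low-digit = m∣n⇒o%n%m≡o%m p (p * p ^ K) x (m∣m*n (p ^ K))
    high-digits : x % (p * p ^ K) / p ≡ x / p % p ^ K
    high-digits = trans (cong (_/ p) (%-congʳ (*-comm p (p ^ K)))) (m%[n*o]/o≡m/o%n x (p ^ K) p)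

-- Counting numbers with few large digits

module FewLargeDigits {p h : ℕ} .{{_ : NonZero p}} (1<p : 1 < p) (p≡1+2h : p ≡ 1 + 2 * h) where

  open LargeDigits 1<p

  M : ℕ
  M = suc h

  p≤2*M : p ≤ 2 * M
  p≤2*M = subst (_≤ 2 * M) (sym p≡1+2h) (≤-trans (n≤1+n _) (≤-reflexive (sym (*-suc 2 h))))

  2*M≡p+1 : 2 * M ≡ p + 1
  2*M≡p+1 = begin
    2 * M         ≡⟨ *-suc 2 h ⟩
    2 + 2 * h     ≡⟨ +-comm 1 (1 + 2 * h) ⟩
    1 + 2 * h + 1 ≡⟨ cong (_+ 1) p≡1+2h ⟨
    p + 1         ∎
    where open ≡-Reasoning

  countFewLarge : ℕ → ℕ → ℕ
  countFewLarge K n = ∑[ w < p ^ K ] 𝟙 (L w <? n)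

  private
    small-digit : ∀ {r} → r < M → large r ≡ 0
    small-digit {r} r<M = 𝟙-no (p <? 2 * r) λ p<2r → <⇒≱ p<2r (begin
      2 * r     ≤⟨ *-monoʳ-≤ 2 (≤-pred r<M) ⟩
      2 * h     <⟨ n<1+n (2 * h) ⟩
      1 + 2 * h ≡⟨ p≡1+2h ⟨
      p         ∎)
      where open ≤-Reasoning

    large-digit : ∀ i → large (M + i) ≡ 1
    large-digit i = 𝟙-yes (p <? 2 * (M + i)) (begin-strict
      p           ≡⟨ p≡1+2h ⟩
      1 + 2 * h   <⟨ n<1+n (1 + 2 * h) ⟩
      2 + 2 * h   ≡⟨ *-suc 2 h ⟨
      2 * M       ≤⟨ *-monoʳ-≤ 2 (m≤m+n M i) ⟩
      2 * (M + i) ∎)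
      where open ≤-Reasoning

    𝟙[1+ℓ<n]≡𝟙[ℓ<n-1] : ∀ ℓ n → 𝟙 (suc ℓ <? n) ≡ 𝟙 (ℓ <? pred n)
    𝟙[1+ℓ<n]≡𝟙[ℓ<n-1] ℓ zero    = refl
    𝟙[1+ℓ<n]≡𝟙[ℓ<n-1] ℓ (suc n) = refl

    ∑-last-digit : ∀ ℓ n →
      ∑[ r < p ] 𝟙 (large r + ℓ <? n) ≡ M * 𝟙 (ℓ <? n) + h * 𝟙 (ℓ <? pred n)
    ∑-last-digit ℓ n = begin
      ∑[ r < p ] 𝟙 (large r + ℓ <? n)
        ≡⟨ cong (λ k → ∑[ r < k ] 𝟙 (large r + ℓ <? n)) p≡M+h ⟩
      ∑[ r < M + h ] 𝟙 (large r + ℓ <? n)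
        ≡⟨ ∑-+ M h _ ⟩
      ∑[ r < M ] 𝟙 (large r + ℓ <? n) + ∑[ i < h ] 𝟙 (large (M + i) + ℓ <? n)
        ≡⟨ cong₂ _+_ (∑-cong M λ r<M → cong (λ d → 𝟙 (d + ℓ <? n)) (small-digit r<M))
                     (∑-cong h λ {i} _ → trans (cong (λ d → 𝟙 (d + ℓ <? n)) (large-digit i))
                                                (𝟙[1+ℓ<n]≡𝟙[ℓ<n-1] ℓ n)) ⟩
      ∑[ r < M ] 𝟙 (ℓ <? n) + ∑[ i < h ] 𝟙 (ℓ <? pred n)
        ≡⟨ cong₂ _+_ (∑-const M _) (∑-const h _) ⟩
      M * 𝟙 (ℓ <? n) + h * 𝟙 (ℓ <? pred n)
        ∎
      where
      open ≡-Reasoning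
      p≡M+h : p ≡ M + h
      p≡M+h = trans p≡1+2h (cong (λ k → suc (h + k)) (+-identityʳ h))

  countFewLarge-suc : ∀ K n →
    countFewLarge (suc K) n ≡ M * countFewLarge K n + h * countFewLarge K (pred n)
  countFewLarge-suc K n = begin
    ∑[ w < p * p ^ K ] 𝟙 (L w <? n)
      ≡⟨ cong (λ k → ∑[ w < k ] 𝟙 (L w <? n)) (*-comm p (p ^ K)) ⟩
    ∑[ w < p ^ K * p ] 𝟙 (L w <? n)
      ≡⟨ ∑-* (p ^ K) p _ ⟩
    ∑[ w < p ^ K ] ∑[ r < p ] 𝟙 (L (r + w * p) <? n)
      ≡⟨ ∑-cong (p ^ K) (λ {w} _ → ∑-cong p λ r<p →
           cong (λ ℓ → 𝟙 (ℓ <? n)) (L-digit w r<p)) ⟩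
    ∑[ w < p ^ K ] ∑[ r < p ] 𝟙 (large r + L w <? n)
      ≡⟨ ∑-cong (p ^ K) (λ {w} _ → ∑-last-digit (L w) n) ⟩
    ∑[ w < p ^ K ] (M * 𝟙 (L w <? n) + h * 𝟙 (L w <? pred n))
      ≡⟨ ∑-distrib-+ (p ^ K) ⟩
    ∑[ w < p ^ K ] (M * 𝟙 (L w <? n)) + ∑[ w < p ^ K ] (h * 𝟙 (L w <? pred n))
      ≡⟨ cong₂ _+_ (∑-*ˡ (p ^ K) M _) (∑-*ˡ (p ^ K) h _) ⟩
    M * countFewLarge K n + h * countFewLarge K (pred n)
      ∎
    where open ≡-Reasoning

  countFewLarge-zero : ∀ K → countFewLarge K 0 ≡ 0
  countFewLarge-zero K = ∑-zero (p ^ K) λ _ → refl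

  countFewLarge≤p^K : ∀ K n → countFewLarge K n ≤ p ^ K
  countFewLarge≤p^K K n = begin
    countFewLarge K n ≤⟨ ∑-mono-≤ (p ^ K) (λ {w} _ → 𝟙≤1 (L w <? n)) ⟩
    ∑[ w < p ^ K ] 1  ≡⟨ ∑-const (p ^ K) 1 ⟩
    p ^ K * 1         ≡⟨ *-identityʳ (p ^ K) ⟩
    p ^ K             ∎
    where open ≤-Reasoning

  private
    recurrence-≤ : ∀ {X Y Z} c a e → X ≤ c * a ^ suc e * Z → Y ≤ c * a ^ e * Z →
                   M * X + h * Y ≤ c * suc a ^ suc e * (M * Z)
    recurrence-≤ {X} {Y} {Z} c a e X≤ Y≤ = begin
      M * X + h * Y
        ≤⟨ +-mono-≤ (*-monoʳ-≤ M X≤) (*-mono-≤ (n≤1+n h) Y≤) ⟩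
      M * (c * a ^ suc e * Z) + M * (c * a ^ e * Z)
        ≡⟨ factor M c (a ^ suc e) (a ^ e) Z ⟩
      c * (a ^ suc e + a ^ e) * (M * Z)
        ≤⟨ *-monoˡ-≤ (M * Z) (*-monoʳ-≤ c a^[1+e]+a^e≤[1+a]^[1+e]) ⟩
      c * suc a ^ suc e * (M * Z)
        ∎
      where
      open ≤-Reasoning
      factor : ∀ M c A B Z → M * (c * A * Z) + M * (c * B * Z) ≡ c * (A + B) * (M * Z)
      factor = solve-∀
      a^[1+e]+a^e≤[1+a]^[1+e] : a ^ suc e + a ^ e ≤ suc a ^ suc e
      a^[1+e]+a^e≤[1+a]^[1+e] = ≤-trans (≤-reflexive (+-comm (a ^ suc e) (a ^ e)))
                                         (*-monoʳ-≤ (suc a) (^-monoˡ-≤ e (n≤1+n a)))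

  countFewLarge-bound : ∀ k c → (∀ m → countFewLarge k (suc m) ≤ c * M ^ k) →
                        ∀ K m → countFewLarge (k + K) (suc m) ≤ c * suc K ^ m * M ^ (k + K)
  countFewLarge-bound k c base zero m rewrite +-identityʳ k | ^-zeroˡ m | *-identityʳ c = base m
  countFewLarge-bound k c base (suc K) m rewrite +-suc k K | countFewLarge-suc (k + K) (suc m) with m
  ... | zero rewrite countFewLarge-zero (k + K) | *-zeroʳ h | +-identityʳ (M * countFewLarge (k + K) 1) =
    ≤-trans (*-monoʳ-≤ M (countFewLarge-bound k c base K 0))
            (≤-reflexive (left-comm M (c * 1) (M ^ (k + K))))
    where
    left-comm : ∀ a b c → a * (b * c) ≡ b * (a * c)
    left-comm = solve-∀
  ... | suc m′ = recurrence-≤ c (suc K) m′ (countFewLarge-bound k c base K (suc m′))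
                                           (countFewLarge-bound k c base K m′)

  countFewLarge≤[1+K]^m*M^K : ∀ K m → countFewLarge K (suc m) ≤ suc K ^ m * M ^ K
  countFewLarge≤[1+K]^m*M^K K m = ≤-trans (countFewLarge-bound 0 1 (λ _ → ≤-refl) K m)
                                          (≤-reflexive (cong (_* M ^ K) (*-identityˡ (suc K ^ m))))

  countFewLarge≤2*K^m*M^K : ∀ K m → countFewLarge (suc K) (suc m) ≤ 2 * suc K ^ m * M ^ suc K
  countFewLarge≤2*K^m*M^K = countFewLarge-bound 1 2 λ m → begin
    countFewLarge 1 (suc m) ≤⟨ countFewLarge≤p^K 1 (suc m) ⟩
    p * 1                   ≤⟨ *-monoˡ-≤ 1 p≤2*M ⟩
    2 * M * 1               ≡⟨ *-assoc 2 M 1 ⟩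
    2 * M ^ 1               ∎
    where open ≤-Reasoning

-- The order of α modulo p

module Order {p α : ℕ} .{{_ : NonZero p}} (p-prime : Prime p) (p∤α : ¬ p ∣ α) where

  private
    1<p : 1 < p
    1<p = prime⇒1<p p-prime

    repeated-residue : ∀ {i j} → i < j → α ^ i % p ≡ α ^ j % p → α ^ (j ∸ i) % p ≡ 1 % p
    repeated-residue {i} {j} i<j eq = begin
      e % p                        ≡⟨ cong (_% p) (m+[n∸m]≡n 1≤e) ⟨
      (1 + (e ∸ 1)) % p            ≡⟨ cong (λ z → (1 + z) % p) (_∣_.equality p∣e-1) ⟩
      (1 + quotient p∣e-1 * p) % p ≡⟨ [m+kn]%n≡m%n 1 (quotient p∣e-1) p ⟩
      1 % p                        ∎
      where
      open ≡-Reasoning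
      e : ℕ
      e = α ^ (j ∸ i)
      1≤e : 1 ≤ e
      1≤e = m^n>0 α {{≢-nonZero λ { refl → p∤α (p ∣0) }}} (j ∸ i)
      α^j≡ : α ^ j ≡ α ^ i + α ^ i * (e ∸ 1)
      α^j≡ = begin
        α ^ j                       ≡⟨ cong (α ^_) (m+[n∸m]≡n (<⇒≤ i<j)) ⟨
        α ^ (i + (j ∸ i))           ≡⟨ ^-distribˡ-+-* α i (j ∸ i) ⟩
        α ^ i * e                   ≡⟨ cong (α ^ i *_) (m+[n∸m]≡n 1≤e) ⟨
        α ^ i * (1 + (e ∸ 1))       ≡⟨ *-distribˡ-+ (α ^ i) 1 (e ∸ 1) ⟩
        α ^ i * 1 + α ^ i * (e ∸ 1) ≡⟨ cong (_+ α ^ i * (e ∸ 1)) (*-identityʳ (α ^ i)) ⟩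
        α ^ i + α ^ i * (e ∸ 1)     ∎
      p∣e-1 : p ∣ e ∸ 1
      p∣e-1 = ∣*∧∤⇒∣ p-prime
        ([m+n]%d≡m%d⇒d∣n (α ^ i) _ p (trans (cong (_% p) (sym α^j≡)) (sym eq))) (∤⇒∤^ p-prime p∤α i)

    ≡1-mod-p : ∀ {x} → x % p ≡ 1 % p → x ≡ 1 + x / p * p
    ≡1-mod-p {x} x≡1 = trans (m≡m%n+[m/n]*n x p) (cong (_+ x / p * p) (trans x≡1 (m<n⇒m%n≡m 1<p)))

    1<α^γ : ∀ {γ} → 1 < α → 1 ≤ γ → 1 < α ^ γ
    1<α^γ {suc γ} 1<α _ =
      ≤-trans 1<α (m≤m*n α (α ^ γ) {{m^n≢0 α γ {{>-nonZero (<-trans z<s 1<α)}}}})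

  order≤p : ∀ {γ} → (∀ k → 1 ≤ k → α ^ k % p ≡ 1 % p → γ ≤ k) → γ ≤ p
  order≤p {γ} minimal with pigeonhole (n<1+n p) residue
    where
    residue : Fin (suc p) → Fin p
    residue i = fromℕ< (m%n<n (α ^ toℕ i) p)
  ... | i , j , i<j , same = begin
    γ             ≤⟨ minimal (toℕ j ∸ toℕ i) (m<n⇒0<n∸m i<j) (repeated-residue i<j same-residue) ⟩
    toℕ j ∸ toℕ i ≤⟨ m∸n≤m (toℕ j) (toℕ i) ⟩
    toℕ j         ≤⟨ ≤-pred (toℕ<n j) ⟩
    p             ∎
    where
    open ≤-Reasoning
    same-residue : α ^ toℕ i % p ≡ α ^ toℕ j % p
    same-residue = trans (sym (toℕ-fromℕ< _)) (trans (cong toℕ same) (toℕ-fromℕ< _))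

  α^γ≡1+p^[1+s]m : ∀ {γ} → 1 < α → 1 ≤ γ → α ^ γ % p ≡ 1 % p →
               ∃₂ λ s m → ¬ p ∣ m × α ^ γ ≡ 1 + p ^ suc s * m
  α^γ≡1+p^[1+s]m {γ} 1<α 1≤γ α^γ≡1 with split-prime-power 1<p (α ^ γ / p) (n≢0⇒n>0 λ q≡0 →
    <-irrefl (sym (trans (≡1-mod-p α^γ≡1) (cong (λ q → 1 + q * p) q≡0))) (1<α^γ 1<α 1≤γ))
  ... | s , m , p∤m , q≡p^s*m = s , m , p∤m , (begin
    α ^ γ             ≡⟨ ≡1-mod-p α^γ≡1 ⟩
    1 + α ^ γ / p * p ≡⟨ cong (λ q → 1 + q * p) q≡p^s*m ⟩
    1 + p ^ s * m * p ≡⟨ cong suc (rotate (p ^ s) m p) ⟩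
    1 + p ^ suc s * m ∎)
    where
    open ≡-Reasoning
    rotate : ∀ a b c → a * b * c ≡ c * a * b
    rotate = solve-∀

-- Exponents in residue classes modulo γ

S≡∑ : ∀ p .{{_ : NonZero p}} α n a → S p α n a ≡ ∑[ t < a ] 𝟙 (largeDigitCount p (α ^ t) <? n)
S≡∑ p α n zero    = refl
S≡∑ p α n (suc a) = cong (_+ 𝟙 (largeDigitCount p (α ^ a) <? n)) (S≡∑ p α n a)

S-zero : ∀ p .{{_ : NonZero p}} α a → S p α 0 a ≡ 0
S-zero p α a = trans (S≡∑ p α 0 a) (∑-zero a λ _ → refl)

S-monoˡ-≤ : ∀ p .{{_ : NonZero p}} α n → a ≤ b → S p α n a ≤ S p α n b
S-monoˡ-≤ {a} {b} p α n a≤b = begin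
  S p α n a                                     ≡⟨ S≡∑ p α n a ⟩
  ∑[ t < a ] 𝟙 (largeDigitCount p (α ^ t) <? n) ≤⟨ ∑-monoˡ-≤ _ a≤b ⟩
  ∑[ t < b ] 𝟙 (largeDigitCount p (α ^ t) <? n) ≡⟨ S≡∑ p α n b ⟨
  S p α n b                                     ∎
  where open ≤-Reasoning

module Windows {p h : ℕ} .{{_ : NonZero p}} (p-prime : Prime p) (p≡1+2h : p ≡ 1 + 2 * h)
               {α γ s m : ℕ} (p∤α : ¬ p ∣ α) (p∤m : ¬ p ∣ m) (α^γ≡ : α ^ γ ≡ 1 + p ^ suc s * m)
  where

  open LargeDigits (prime⇒1<p p-prime)
  open LiftingTheExponent {h = h} p-prime p≡1+2h
  open FewLargeDigits {h = h} (prime⇒1<p p-prime) p≡1+2h using (countFewLarge)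

  window : ℕ → ℕ → ℕ → ℕ
  window K c j = α ^ (c + j * γ) / p ^ suc s % p ^ K
    where
    instance
      _ = m^n≢0 p (suc s)
      _ = m^n≢0 p K

  -- α ^ (γ d) = 1 + p ^ (s + 1) D, so moving from j to j + d adds X D to
  -- α ^ (c + j γ) / p ^ (s + 1), where X = α ^ (c + j γ) is prime to p.
  window-shift : ∀ K c j d → window K c (j + d) ≡ window K c j → p ^ K ∣ d
  window-shift K c j d eq = lifting-the-exponent K s p∤m α^γd≡ p^K∣D
    where
    open ≡-Reasoning
    instance
      _ = m^n≢0 p (suc s)
      _ = m^n≢0 p K
    y X P D : ℕ
    y = proj₁ (first-order-expansion s m d)
    X = α ^ (c + j * γ)
    P = p ^ suc s
    D = d * m + p * y
    α^γd≡ : (1 + P * m) ^ d ≡ 1 + P * D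
    α^γd≡ = proj₂ (first-order-expansion s m d)
    shifted : α ^ (c + (j + d) * γ) ≡ X + X * D * P
    shifted = begin
      α ^ (c + (j + d) * γ)
        ≡⟨ cong (α ^_) (trans (cong (c +_) (*-distribʳ-+ γ j d)) (sym (+-assoc c _ _))) ⟩
      α ^ (c + j * γ + d * γ) ≡⟨ ^-distribˡ-+-* α (c + j * γ) (d * γ) ⟩
      X * α ^ (d * γ)         ≡⟨ cong (λ e → X * α ^ e) (*-comm d γ) ⟩
      X * α ^ (γ * d)         ≡⟨ cong (X *_) (^-*-assoc α γ d) ⟨
      X * (α ^ γ) ^ d         ≡⟨ cong (λ β → X * β ^ d) α^γ≡ ⟩
      X * (1 + P * m) ^ d     ≡⟨ cong (X *_) α^γd≡ ⟩
      X * (1 + P * D)         ≡⟨ expand X P D ⟩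
      X + X * D * P           ∎
      where
      expand : ∀ X P D → X * (1 + P * D) ≡ X + X * D * P
      expand = solve-∀
    p^K∣XD : p ^ K ∣ X * D
    p^K∣XD = [m+n]%d≡m%d⇒d∣n (X / P) (X * D) (p ^ K) (begin
      (X / P + X * D) % p ^ K         ≡⟨ cong (λ z → (X / P + z) % p ^ K) (m*n/n≡m (X * D) P) ⟨
      (X / P + X * D * P / P) % p ^ K ≡⟨ cong (_% p ^ K) (+-distrib-/-∣ʳ X {d = P} (n∣m*n (X * D))) ⟨
      (X + X * D * P) / P % p ^ K     ≡⟨ cong (λ z → z / P % p ^ K) shifted ⟨
      window K c (j + d)              ≡⟨ eq ⟩
      X / P % p ^ K                   ∎)
    p^K∣D : p ^ K ∣ D
    p^K∣D = ^∣*∧∤⇒^∣ p-prime K p^K∣XD (∤⇒∤^ p-prime p∤α (c + j * γ))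

  private
    window-≢ : ∀ K c {i k} → i < k → k < p ^ K → window K c i ≢ window K c k
    window-≢ K c {i} {k} i<k k<p^K eq = <⇒≱ (≤-<-trans (m∸n≤m k i) k<p^K)
      (∣⇒≤ {{>-nonZero (m<n⇒0<n∸m i<k)}} (window-shift K c i (k ∸ i)
        (trans (cong (window K c) (m+[n∸m]≡n (<⇒≤ i<k))) (sym eq))))

  window-injective : ∀ K c {j j′} → j < p ^ K → j′ < p ^ K →
                     window K c j ≡ window K c j′ → j ≡ j′
  window-injective K c {j} {j′} j<p^K j′<p^K eq with <-cmp j j′
  ... | tri< j<j′ _ _ = contradiction eq (window-≢ K c j<j′ j′<p^K)
  ... | tri≈ _ j≡j′ _ = j≡j′
  ... | tri> _ _ j′<j = contradiction (sym eq) (window-≢ K c j′<j j<p^K)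

  isFewLarge : ℕ → ℕ → ℕ
  isFewLarge n t = 𝟙 (L (α ^ t) <? n)

  residue-class-≤ : ∀ K n c → ∑[ j < p ^ K ] isFewLarge n (c + j * γ) ≤ countFewLarge K n
  residue-class-≤ K n c = begin
    ∑[ j < p ^ K ] isFewLarge n (c + j * γ)
      ≤⟨ ∑-mono-≤ (p ^ K) (λ {j} _ → 𝟙-mono (_ <? n) (_ <? n) (≤-<-trans (L-window j))) ⟩
    ∑[ j < p ^ K ] 𝟙 (L (window K c j) <? n)
      ≤⟨ ∑-injective-≤ (window K c) (λ _ → m%n<n _ (p ^ K) {{m^n≢0 p K}}) (window-injective K c)
                       (λ w → 𝟙 (L w <? n)) ⟩
    countFewLarge K n
      ∎
    where
    open ≤-Reasoning
    L-window : ∀ j → L (window K c j) ≤ L (α ^ (c + j * γ))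
    L-window j = ≤-trans (L-%p^ K _) (L-/p^ (suc s) _)

  block-≤ : ∀ K n b → ∑[ i < p ^ K * γ ] isFewLarge n (b + i) ≤ γ * countFewLarge K n
  block-≤ K n b = begin
    ∑[ i < p ^ K * γ ] isFewLarge n (b + i)
      ≡⟨ ∑-* (p ^ K) γ _ ⟩
    ∑[ j < p ^ K ] ∑[ i < γ ] isFewLarge n (b + (i + j * γ))
      ≡⟨ ∑-comm (p ^ K) γ _ ⟩
    ∑[ i < γ ] ∑[ j < p ^ K ] isFewLarge n (b + (i + j * γ))
      ≡⟨ ∑-cong γ (λ {i} _ → ∑-cong (p ^ K) λ {j} _ →
           cong (isFewLarge n) (+-assoc b i (j * γ))) ⟨
    ∑[ i < γ ] ∑[ j < p ^ K ] isFewLarge n (b + i + j * γ)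
      ≤⟨ ∑-mono-≤ γ (λ {i} _ → residue-class-≤ K n (b + i)) ⟩
    ∑[ i < γ ] countFewLarge K n
      ≡⟨ ∑-const γ _ ⟩
    γ * countFewLarge K n
      ∎
    where open ≤-Reasoning

  S-blocks-≤ : ∀ K n B → S p α n (B * (p ^ K * γ)) ≤ B * (γ * countFewLarge K n)
  S-blocks-≤ K n B = begin
    S p α n (B * (p ^ K * γ))
      ≡⟨ S≡∑ p α n (B * (p ^ K * γ)) ⟩
    ∑[ t < B * (p ^ K * γ) ] isFewLarge n t
      ≡⟨ ∑-* B (p ^ K * γ) _ ⟩
    ∑[ k < B ] ∑[ i < p ^ K * γ ] isFewLarge n (i + k * (p ^ K * γ))
      ≡⟨ ∑-cong B (λ {k} _ → ∑-cong (p ^ K * γ) λ {i} _ →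
           cong (isFewLarge n) (+-comm i (k * (p ^ K * γ)))) ⟩
    ∑[ k < B ] ∑[ i < p ^ K * γ ] isFewLarge n (k * (p ^ K * γ) + i)
      ≤⟨ ∑-mono-≤ B (λ {k} _ → block-≤ K n (k * (p ^ K * γ))) ⟩
    ∑[ k < B ] (γ * countFewLarge K n)
      ≡⟨ ∑-const B _ ⟩
    B * (γ * countFewLarge K n)
      ∎
    where open ≤-Reasoning

-- Leading digits

record LeadingDigit (p q : ℕ) : Set where
  field
    exponent digit : ℕ
    1≤digit : 1 ≤ digit
    digit<p : digit < p
    lower   : digit * p ^ exponent ≤ q
    upper   : q < suc digit * p ^ exponent

module _ {p : ℕ} .{{_ : NonZero p}} (1<p : 1 < p) where

  leadingDigit-*p : ∀ {q} → LeadingDigit p (q / p) → LeadingDigit p q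
  leadingDigit-*p {q} d = record
    { exponent = suc exponent
    ; digit    = digit
    ; 1≤digit  = 1≤digit
    ; digit<p  = digit<p
    ; lower    = begin
        digit * (p * p ^ exponent)     ≡⟨ rotate digit p (p ^ exponent) ⟩
        digit * p ^ exponent * p       ≤⟨ *-monoˡ-≤ p lower ⟩
        q / p * p                      ≤⟨ m/n*n≤m q p ⟩
        q                              ∎
    ; upper    = begin-strict
        q                              ≡⟨ m≡m%n+[m/n]*n q p ⟩
        q % p + q / p * p              <⟨ +-monoˡ-< (q / p * p) (m%n<n q p) ⟩
        suc (q / p) * p                ≤⟨ *-monoˡ-≤ p upper ⟩
        suc digit * p ^ exponent * p   ≡⟨ rotate (suc digit) p (p ^ exponent) ⟨
        suc digit * (p * p ^ exponent) ∎
    }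
    where
    open LeadingDigit d
    open ≤-Reasoning
    rotate : ∀ a b c → a * (b * c) ≡ a * c * b
    rotate = solve-∀

  leadingDigit : ∀ q → 1 ≤ q → LeadingDigit p q
  leadingDigit = <-rec _ λ q rec 1≤q → case q <? p of λ where
    (yes q<p) → record
      { exponent = 0 ; digit = q ; 1≤digit = 1≤q ; digit<p = q<p
      ; lower = ≤-reflexive (*-identityʳ q) ; upper = ≤-reflexive (cong suc (sym (*-identityʳ q))) }
    (no q≮p) → leadingDigit-*p (rec (m/n<m q p {{>-nonZero 1≤q}} 1<p) (m≥n⇒m/n>0 (≮⇒≥ q≮p)))

module _ {p γ : ℕ} .{{_ : NonZero γ}} where

  leadingDigit-lower : ∀ {a} (d : LeadingDigit p (a / γ)) →
                       LeadingDigit.digit d * γ * p ^ LeadingDigit.exponent d ≤ a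
  leadingDigit-lower {a} d = begin
    digit * γ * p ^ exponent ≡⟨ swap digit γ (p ^ exponent) ⟩
    digit * p ^ exponent * γ ≤⟨ *-monoˡ-≤ γ lower ⟩
    a / γ * γ                ≤⟨ m/n*n≤m a γ ⟩
    a                        ∎
    where
    open LeadingDigit d
    open ≤-Reasoning
    swap : ∀ x y z → x * y * z ≡ x * z * y
    swap = solve-∀

  leadingDigit-upper : ∀ {a} (d : LeadingDigit p (a / γ)) →
                       a ≤ suc (LeadingDigit.digit d) * (p ^ LeadingDigit.exponent d * γ)
  leadingDigit-upper {a} d = <⇒≤ (begin-strict
    a                              ≡⟨ m≡m%n+[m/n]*n a γ ⟩
    a % γ + a / γ * γ              <⟨ +-monoˡ-< (a / γ * γ) (m%n<n a γ) ⟩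
    suc (a / γ) * γ                ≤⟨ *-monoˡ-≤ γ upper ⟩
    suc digit * p ^ exponent * γ   ≡⟨ *-assoc (suc digit) (p ^ exponent) γ ⟩
    suc digit * (p ^ exponent * γ) ∎)
    where
    open LeadingDigit d
    open ≤-Reasoning

module _ {p h : ℕ} .{{_ : NonZero p}} (p-prime : Prime p) (p≡1+2h : p ≡ 1 + 2 * h) where

  open FewLargeDigits {h = h} (prime⇒1<p p-prime) p≡1+2h using (countFewLarge)

  S-≤-leadingDigit : ∀ {α γ a} .{{_ : NonZero γ}} → ¬ p ∣ α →
    (∃₂ λ s m → ¬ p ∣ m × α ^ γ ≡ 1 + p ^ suc s * m) → ∀ n (d : LeadingDigit p (a / γ)) →
    S p α n a ≤ 2 * (LeadingDigit.digit d * γ) * countFewLarge (LeadingDigit.exponent d) n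
  S-≤-leadingDigit {α} {γ} {a} p∤α (s , m , p∤m , α^γ≡) n d = begin
    S p α n a                                ≤⟨ S-monoˡ-≤ p α n (leadingDigit-upper d) ⟩
    S p α n (suc digit * (p ^ exponent * γ)) ≤⟨ S-blocks-≤ exponent n (suc digit) ⟩
    suc digit * (γ * C)                      ≤⟨ *-monoˡ-≤ (γ * C) (+-monoˡ-≤ digit 1≤digit) ⟩
    (digit + digit) * (γ * C)                ≡⟨ regroup digit γ C ⟩
    2 * (digit * γ) * C                      ∎
    where
    open Windows {h = h} p-prime p≡1+2h {γ = γ} {s = s} p∤α p∤m α^γ≡
    open LeadingDigit d
    open ≤-Reasoning
    C : ℕ
    C = countFewLarge exponent n
    regroup : ∀ b g c → (b + b) * (g * c) ≡ 2 * (b * g) * c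
    regroup = solve-∀

-- From counts to the logarithmic bound

module LogBounds {p M : ℕ} (1<p : 1 < p) (p≤2*M : p ≤ 2 * M) where

  private instance
    p-nonZero : NonZero p
    p-nonZero = >-nonZero (<-trans z<s 1<p)

  1≤M : 1 ≤ M
  1≤M = *-cancelˡ-≤ 2 (≤-trans 1<p p≤2*M)

  log-≤ : ∀ {a} J u v → p ^ J ≤ a → a ^ v ≤ p ^ u → J * v ≤ u
  log-≤ {a} J u v p^J≤a a^v≤p^u = ^-cancelʳ-≤ 1<p (begin
    p ^ (J * v) ≡⟨ ^-*-assoc p J v ⟨
    (p ^ J) ^ v ≤⟨ ^-monoˡ-≤ v p^J≤a ⟩
    a ^ v       ≤⟨ a^v≤p^u ⟩
    p ^ u       ∎)
    where open ≤-Reasoning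

  ≤2^*M^ : ∀ {z e f} → z ≤ p ^ e → z ≤ p ^ f → z ≤ 2 ^ e * M ^ f
  ≤2^*M^ {z} {e} {f} z≤p^e z≤p^f with f ≤? e
  ... | yes f≤e = begin
    z             ≤⟨ z≤p^f ⟩
    p ^ f         ≤⟨ ^-monoˡ-≤ f p≤2*M ⟩
    (2 * M) ^ f   ≡⟨ ^-distribʳ-* 2 M f ⟩
    2 ^ f * M ^ f ≤⟨ *-monoˡ-≤ (M ^ f) (^-monoʳ-≤ 2 f≤e) ⟩
    2 ^ e * M ^ f ∎
    where open ≤-Reasoning
  ... | no f≰e = begin
    z             ≤⟨ z≤p^e ⟩
    p ^ e         ≤⟨ ^-monoˡ-≤ e p≤2*M ⟩
    (2 * M) ^ e   ≡⟨ ^-distribʳ-* 2 M e ⟩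
    2 ^ e * M ^ e ≤⟨ *-monoʳ-≤ (2 ^ e) (^-monoʳ-≤ M {{>-nonZero 1≤M}} (<⇒≤ (≰⇒> f≰e))) ⟩
    2 ^ e * M ^ f ∎
    where open ≤-Reasoning

  -- With a ^ v ≤ p ^ u read as log_p a ≤ u / v: if y ≤ p ^ j then
  -- y ≤ 2 ^ j M ^ (log_p y), and log_p y + K ≤ log_p a, so c y M ^ K ≤ 8 M ^ (log_p a).
  leading-term-≤ : ∀ {y a} c j K u v → c * 2 ^ j ≡ 8 → 1 ≤ y → y ≤ p ^ j → y * p ^ K ≤ a →
                   a ^ v ≤ p ^ u → (c * (y * M ^ K)) ^ v ≤ 8 ^ v * M ^ u
  leading-term-≤ {y} {a} c j K u v c*2^j≡8 1≤y y≤p^j yp^K≤a a^v≤p^u = begin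
    (c * (y * M ^ K)) ^ v
      ≡⟨ trans (^-distribʳ-* c _ v) (cong (c ^ v *_) (^-distribʳ-* y (M ^ K) v)) ⟩
    c ^ v * (y ^ v * (M ^ K) ^ v)
      ≤⟨ *-monoʳ-≤ (c ^ v) (*-monoˡ-≤ ((M ^ K) ^ v) y^v≤) ⟩
    c ^ v * (2 ^ (j * v) * M ^ (u ∸ K * v) * (M ^ K) ^ v)
      ≡⟨ assoc (c ^ v) (2 ^ (j * v)) (M ^ (u ∸ K * v)) ((M ^ K) ^ v) ⟩
    c ^ v * 2 ^ (j * v) * (M ^ (u ∸ K * v) * (M ^ K) ^ v)
      ≡⟨ cong₂ _*_ c^v*2^jv≡8^v M^[u-Kv]*M^Kv≡M^u ⟩
    8 ^ v * M ^ u
      ∎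
    where
    open ≤-Reasoning
    Kv≤u : K * v ≤ u
    Kv≤u = log-≤ K u v (≤-trans (m≤n*m (p ^ K) y {{>-nonZero 1≤y}}) yp^K≤a) a^v≤p^u
    y^v*p^Kv≤p^u : y ^ v * p ^ (K * v) ≤ p ^ u
    y^v*p^Kv≤p^u = begin
      y ^ v * p ^ (K * v) ≡⟨ cong (y ^ v *_) (^-*-assoc p K v) ⟨
      y ^ v * (p ^ K) ^ v ≡⟨ ^-distribʳ-* y (p ^ K) v ⟨
      (y * p ^ K) ^ v     ≤⟨ ^-monoˡ-≤ v yp^K≤a ⟩
      a ^ v               ≤⟨ a^v≤p^u ⟩
      p ^ u               ∎
    y^v≤p^[u-Kv] : y ^ v ≤ p ^ (u ∸ K * v)
    y^v≤p^[u-Kv] = *-cancelʳ-≤ (y ^ v) _ (p ^ (K * v)) {{m^n≢0 p (K * v)}} (begin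
      y ^ v * p ^ (K * v)           ≤⟨ y^v*p^Kv≤p^u ⟩
      p ^ u                         ≡⟨ cong (p ^_) (m∸n+n≡m Kv≤u) ⟨
      p ^ (u ∸ K * v + K * v)       ≡⟨ ^-distribˡ-+-* p (u ∸ K * v) (K * v) ⟩
      p ^ (u ∸ K * v) * p ^ (K * v) ∎)
    y^v≤ : y ^ v ≤ 2 ^ (j * v) * M ^ (u ∸ K * v)
    y^v≤ = ≤2^*M^ {e = j * v} {f = u ∸ K * v}
             (≤-trans (^-monoˡ-≤ v y≤p^j) (≤-reflexive (^-*-assoc p j v))) y^v≤p^[u-Kv]
    assoc : ∀ a b c d → a * (b * c * d) ≡ a * b * (c * d)
    assoc = solve-∀
    c^v*2^jv≡8^v : c ^ v * 2 ^ (j * v) ≡ 8 ^ v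
    c^v*2^jv≡8^v = trans (cong (c ^ v *_) (sym (^-*-assoc 2 j v)))
                         (trans (sym (^-distribʳ-* c (2 ^ j) v)) (cong (_^ v) c*2^j≡8))
    M^[u-Kv]*M^Kv≡M^u : M ^ (u ∸ K * v) * (M ^ K) ^ v ≡ M ^ u
    M^[u-Kv]*M^Kv≡M^u = begin-equality
      M ^ (u ∸ K * v) * (M ^ K) ^ v   ≡⟨ cong (M ^ (u ∸ K * v) *_) (^-*-assoc M K v) ⟩
      M ^ (u ∸ K * v) * M ^ (K * v)   ≡⟨ ^-distribˡ-+-* M (u ∸ K * v) (K * v) ⟨
      M ^ (u ∸ K * v + K * v)         ≡⟨ cong (M ^_) (m∸n+n≡m Kv≤u) ⟩
      M ^ u                           ∎

boundHolds-zero : ∀ p a → BoundHolds p 0 a 0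
boundHolds-zero p a u (suc v) _ _ = z≤n

-- T ≤ Z J ^ m gives the bound for n = m + 1 once J ≤ log_p a and Z ≤ 8 M ^ (log_p a),
-- both tested against every rational u / v ≥ log_p a.
boundHolds-suc : ∀ {p a T m} M Z J → 2 * M ≡ p + 1 → T ≤ Z * J ^ m →
                 (∀ u v → a ^ v ≤ p ^ u → J * v ≤ u × Z ^ v ≤ 8 ^ v * M ^ u) →
                 BoundHolds p (suc m) a T
boundHolds-suc {p} {a} {T} {m} M Z J 2M≡p+1 T≤ZJ^m estimates u v _ a^v≤p^u = begin
  T ^ v * u ^ v * v ^ (suc m * v) * 2 ^ u
    ≤⟨ *-monoˡ-≤ (2 ^ u) (*-monoˡ-≤ (v ^ (suc m * v))
         (*-monoˡ-≤ (u ^ v) (^-monoˡ-≤ v T≤ZJ^m))) ⟩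
  (Z * J ^ m) ^ v * u ^ v * v ^ (suc m * v) * 2 ^ u
    ≡⟨ cong₂ (λ x y → x * u ^ v * y * 2 ^ u)
             (trans (^-distribʳ-* Z (J ^ m) v) (cong (Z ^ v *_) (^-*-assoc J m v)))
             (^-distribˡ-+-* v v (m * v)) ⟩
  Z ^ v * J ^ (m * v) * u ^ v * (v ^ v * v ^ (m * v)) * 2 ^ u
    ≡⟨ shuffle₁ (Z ^ v) (J ^ (m * v)) (u ^ v) (v ^ v) (v ^ (m * v)) (2 ^ u) ⟩
  Z ^ v * (J ^ (m * v) * v ^ (m * v)) * (u ^ v * v ^ v * 2 ^ u)
    ≡⟨ cong (λ x → Z ^ v * x * (u ^ v * v ^ v * 2 ^ u)) (^-distribʳ-* J v (m * v)) ⟨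
  Z ^ v * (J * v) ^ (m * v) * (u ^ v * v ^ v * 2 ^ u)
    ≤⟨ *-monoˡ-≤ (u ^ v * v ^ v * 2 ^ u) (*-mono-≤ Z^v≤ (^-monoˡ-≤ (m * v) Jv≤u)) ⟩
  8 ^ v * M ^ u * u ^ (m * v) * (u ^ v * v ^ v * 2 ^ u)
    ≡⟨ shuffle₂ (8 ^ v) (M ^ u) (u ^ (m * v)) (u ^ v) (v ^ v) (2 ^ u) ⟩
  8 ^ v * (u ^ v * u ^ (m * v)) * v ^ v * (2 ^ u * M ^ u)
    ≡⟨ cong₂ (λ x y → 8 ^ v * x * v ^ v * y)
             (^-distribˡ-+-* u v (m * v))
             (trans (cong (_^ u) (sym 2M≡p+1)) (^-distribʳ-* 2 M u)) ⟨
  8 ^ v * u ^ (suc m * v) * v ^ v * (p + 1) ^ u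
    ∎
  where
  open ≤-Reasoning
  Jv≤u : J * v ≤ u
  Jv≤u = proj₁ (estimates u v a^v≤p^u)
  Z^v≤ : Z ^ v ≤ 8 ^ v * M ^ u
  Z^v≤ = proj₂ (estimates u v a^v≤p^u)
  shuffle₁ : ∀ z j x y w t → z * j * x * (y * w) * t ≡ z * (j * w) * (x * y * t)
  shuffle₁ = solve-∀
  shuffle₂ : ∀ e z w x y t → e * z * w * (x * y * t) ≡ e * (x * w) * y * (t * z)
  shuffle₂ = solve-∀

module _ {p h : ℕ} .{{_ : NonZero p}} (1<p : 1 < p) (p≡1+2h : p ≡ 1 + 2 * h) where

  open FewLargeDigits {h = h} 1<p p≡1+2h
  open LogBounds {M = M} 1<p p≤2*M

  -- For y < p the count bound 2 K ^ m M ^ K is used with J = K; for y ≥ p the extra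
  -- factor p in y p ^ K ≤ a pays for J = K + 1 in (K + 1) ^ m M ^ K.
  boundHolds-fromCount : ∀ {a y K m T} → 1 ≤ y → y ≤ p ^ 2 → y * p ^ suc K ≤ a →
                         T ≤ 2 * y * countFewLarge (suc K) (suc m) → BoundHolds p (suc m) a T
  boundHolds-fromCount {a} {y} {K} {m} {T} 1≤y y≤p² yp^K≤a T≤ with y <? p
  ... | yes y<p = boundHolds-suc {m = m} M (4 * (y * M ^ suc K)) (suc K) 2*M≡p+1 T≤ZJ^m
      λ u v a^v≤p^u →
          log-≤ (suc K) u v (≤-trans (m≤n*m (p ^ suc K) y {{>-nonZero 1≤y}}) yp^K≤a) a^v≤p^u
        , leading-term-≤ 4 1 (suc K) u v refl 1≤y y≤p^1 yp^K≤a a^v≤p^u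
    where
    open ≤-Reasoning
    y≤p^1 : y ≤ p ^ 1
    y≤p^1 = ≤-trans (<⇒≤ y<p) (≤-reflexive (sym (*-identityʳ p)))
    T≤ZJ^m : T ≤ 4 * (y * M ^ suc K) * suc K ^ m
    T≤ZJ^m = begin
      T                                     ≤⟨ T≤ ⟩
      2 * y * countFewLarge (suc K) (suc m) ≤⟨ *-monoʳ-≤ (2 * y) (countFewLarge≤2*K^m*M^K K m) ⟩
      2 * y * (2 * suc K ^ m * M ^ suc K)   ≡⟨ regroup y (suc K ^ m) (M ^ suc K) ⟩
      4 * (y * M ^ suc K) * suc K ^ m       ∎
      where
      regroup : ∀ y x z → 2 * y * (2 * x * z) ≡ 4 * (y * z) * x
      regroup = solve-∀
  ... | no y≮p = boundHolds-suc {m = m} M (2 * (y * M ^ suc K)) (suc (suc K)) 2*M≡p+1 T≤ZJ^m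
      λ u v a^v≤p^u →
          log-≤ (suc (suc K)) u v p^[2+K]≤a a^v≤p^u
        , leading-term-≤ 2 2 (suc K) u v refl 1≤y y≤p² yp^K≤a a^v≤p^u
    where
    open ≤-Reasoning
    p^[2+K]≤a : p ^ suc (suc K) ≤ a
    p^[2+K]≤a = ≤-trans (*-monoˡ-≤ (p ^ suc K) (≮⇒≥ y≮p)) yp^K≤a
    T≤ZJ^m : T ≤ 2 * (y * M ^ suc K) * suc (suc K) ^ m
    T≤ZJ^m = begin
      T                                     ≤⟨ T≤ ⟩
      2 * y * countFewLarge (suc K) (suc m) ≤⟨ *-monoʳ-≤ (2 * y) (countFewLarge≤[1+K]^m*M^K _ m) ⟩
      2 * y * (suc (suc K) ^ m * M ^ suc K) ≡⟨ regroup y (suc (suc K) ^ m) (M ^ suc K) ⟩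
      2 * (y * M ^ suc K) * suc (suc K) ^ m ∎
      where
      regroup : ∀ y x z → 2 * y * (x * z) ≡ 2 * (y * z) * x
      regroup = solve-∀

theorem2p16 : (p : ℕ) → .{{_ : NonZero p}} → Prime p → p % 2 ≡ 1 →
              (α : ℕ) → 1 < α → gcd α p ≡ 1 →
              (γ : ℕ) → IsOrderMod p α γ →
              (a n : ℕ) → γ * p ≤ a →
              BoundHolds p n a (S p α n a)
theorem2p16 p p-prime p-odd α 1<α gcd≡1 γ _ a zero _ =
  subst (BoundHolds p 0 a) (sym (S-zero p α a)) (boundHolds-zero p a)
theorem2p16 p p-prime p-odd α 1<α gcd≡1 γ (1≤γ , α^γ≡1 , minimal) a (suc n) γp≤a =
  boundHolds-fromCount {h = p / 2} 1<p p≡1+2h {K = LeadingDigit.exponent d₀} {m = n}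
    (*-mono-≤ 1≤digit 1≤γ) y≤p² (leadingDigit-lower {γ = γ} d)
    (S-≤-leadingDigit {h = p / 2} p-prime p≡1+2h {γ = γ} {a} p∤α
                      (α^γ≡1+p^[1+s]m 1<α 1≤γ α^γ≡1) (suc n) d)
  where
  instance
    γ-nonZero : NonZero γ
    γ-nonZero = >-nonZero 1≤γ
  1<p : 1 < p
  1<p = prime⇒1<p p-prime
  p≡1+2h : p ≡ 1 + 2 * (p / 2)
  p≡1+2h = odd⇒≡1+2*[n/2] p p-odd
  p∤α : ¬ p ∣ α
  p∤α = gcd≡1⇒∤ 1<p gcd≡1
  open Order p-prime p∤α
  p≤a/γ : p ≤ a / γ
  p≤a/γ = subst (_≤ a / γ) (m*n/n≡m p γ) (/-monoˡ-≤ γ (subst (_≤ a) (*-comm γ p) γp≤a))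
  d₀ : LeadingDigit p (a / γ / p)
  d₀ = leadingDigit 1<p (a / γ / p) (m≥n⇒m/n>0 p≤a/γ)
  d : LeadingDigit p (a / γ)
  d = leadingDigit-*p 1<p d₀
  open LeadingDigit d
  y≤p² : digit * γ ≤ p ^ 2
  y≤p² = ≤-trans (*-mono-≤ (<⇒≤ digit<p) (order≤p minimal))
                 (≤-reflexive (cong (p *_) (sym (*-identityʳ p))))
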